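{- Let $p,q$ be positive integers with $p/q\ge 2$, let $G$ be a connected graph with a fixed orientation, and let $\varphi,\psi$ be two $(p,q)$-labellings of $G$. Then $\varphi$ can be transformed into $\psi$ by a finite sequence of edge cut relabellings if and only if $\varphi(C)=\psi(C)$ for every cycle $C$ of $G$ (with the same direction of traversal used for both).
   Context: Fix an orientation of each edge of $G$. For an edge-labelling $\varphi:E(G)\to\{0,1,\dots,p-1\}$ and a cycle $C$ (or path $P$) with a chosen direction of traversal, let $\varphi(C)=\sum_{e\text{ forward}}\varphi(e)+\sum_{e\text{ backward}}(p-\varphi(e))$, the sum taken in $\mathbb{Z}$, where an edge is forward if its orientation agrees with the direction of traversal and backward otherwise. A $(p,q)$-labelling of $G$ is an edge-labelling $\varphi:E(G)\to\{0,\dots,p-1\}$ such that $q\le\varphi(e)\le p-q$ for all edges $e$ and $\varphi(C)\equiv 0\pmod p$ for all cycles $C$. For $\emptyset\ne X\subsetneq V(G)$, let $\partial^+(X)$ be the set of edges oriented from $X$ to $V(G)\setminus X$ and $\partial^-(X)$ the set oriented from $V(G)\setminus X$ to $X$. Given a $(p,q)$-labelling $\varphi$ and an integer $1\le\alpha\le p-1$ with $\varphi(e)\ge q+\alpha$ for all $e\in\partial^+(X)$ and $\varphi(e)\le p-q-\alpha$ for all $e\in\partial^-(X)$, the edge cut relabelling of $\varphi$ on $\partial(X)$ by $\alpha$ produces $\varphi'$ with $\varphi'(e)=\varphi(e)-\alpha$ for $e\in\partial^+(X)$, $\varphi'(e)=\varphi(e)+\alpha$ for $e\in\partial^-(X)$,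 and $\varphi'(e)=\varphi(e)$ otherwise. -}

module Defs where

open import Data.Nat using (ℕ; zero; suc; _+_; _*_; _∸_; _≤_; _<?_)
open import Data.Fin using (Fin; toℕ; fromℕ<)
open import Data.Bool using (Bool; true; false)
open import Data.List using (List; map; allFin)
open import Data.Nat.ListAction using (sum)
open import Data.Nat.Divisibility using (_∣_)
open import Data.Product using (Σ; _×_; _,_; ∃)
open import Data.Sum using (_⊎_)
open import Relation.Nullary using (¬_; yes; no)
open import Relation.Binary.PropositionalEquality using (_≡_)
open import Relation.Binary.Construct.Closure.ReflexiveTransitive using (Star)

record OrientedGraph : Set where
  field
    n m      : ℕ
    tail     : Fin m → Fin n
    head     : Fin m → Fin n
    loopless : ∀ e → ¬ (tail e ≡ head e)
    simple   : ∀ e f →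
               ((tail e ≡ tail f × head e ≡ head f) ⊎ (tail e ≡ head f × head e ≡ tail f)) →
               e ≡ f

module _ (G : OrientedGraph) where
  open OrientedGraph G

  Adj : Fin n → Fin n → Set
  Adj u v = Σ (Fin m) λ e → (tail e ≡ u × head e ≡ v) ⊎ (tail e ≡ v × head e ≡ u)

  Connected : Set
  Connected = ∀ u v → Star Adj u v

  Dart : Set
  Dart = Fin m × Bool

  src : Dart → Fin n
  src (e , true)  = tail e
  src (e , false) = head e

  tgt : Dart → Fin n
  tgt (e , true)  = head e
  tgt (e , false) = tail e

next : ∀ {k} → Fin k → Fin k
next {suc k} i with suc (toℕ i) <? suc k
... | yes lt = fromℕ< lt
... | no _   = Fin.zero

module _ (G : OrientedGraph) where
  open OrientedGraph G

  record Cycle : Set where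
    field
      len      : ℕ
      len≥3    : 3 ≤ len
      dart     : Fin len → Dart G
      closed   : ∀ i → tgt G (dart i) ≡ src G (dart (next i))
      distinct : ∀ i j → src G (dart i) ≡ src G (dart j) → i ≡ j

  Labelling : Set
  Labelling = Fin m → ℕ

  dartValue : ℕ → Labelling → Dart G → ℕ
  dartValue p φ (e , true)  = φ e
  dartValue p φ (e , false) = p ∸ φ e

  -- φ(C), computed in ℕ (all summands are nonnegative integers)
  cycleValue : ℕ → Labelling → Cycle → ℕ
  cycleValue p φ C = sum (map (λ i → dartValue p φ (Cycle.dart C i)) (allFin (Cycle.len C)))

  IsPQLabelling : ℕ → ℕ → Labelling → Set
  IsPQLabelling p q φ =
    (∀ e → q ≤ φ e × φ e ≤ p ∸ q) × (∀ (C : Cycle) → p ∣ cycleValue p φ C)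

  Out : (Fin n → Bool) → Fin m → Set
  Out X e = X (tail e) ≡ true × X (head e) ≡ false

  In : (Fin n → Bool) → Fin m → Set
  In X e = X (tail e) ≡ false × X (head e) ≡ true

  relabel : (Fin n → Bool) → ℕ → Labelling → Labelling
  relabel X α φ e with X (tail e) | X (head e)
  ... | true  | false = φ e ∸ α
  ... | false | true  = φ e + α
  ... | _     | _     = φ e

  EdgeCutRelabelling : ℕ → ℕ → Labelling → Labelling → Set
  EdgeCutRelabelling p q φ φ' =
    IsPQLabelling p q φ ×
    Σ (Fin n → Bool) λ X →
      (∃ λ v → X v ≡ true) × (∃ λ v → X v ≡ false) ×
      Σ ℕ λ α → 1 ≤ α × α ≤ p ∸ 1 ×
        (∀ e → Out X e → q + α ≤ φ e) ×
        (∀ e → In X e → φ e + α ≤ p ∸ q) ×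
        (∀ e → φ' e ≡ relabel X α φ e)

  Reconfigurable : ℕ → ℕ → Labelling → Labelling → Set
  Reconfigurable p q φ ψ =
    Σ Labelling λ χ → Star (EdgeCutRelabelling p q) φ χ × (∀ e → χ e ≡ ψ e)

-- Edge cut relabelling by α on ∂(X) adds to φ the coboundary of the potential α·[v ∈ X], and a
-- coboundary telescopes to zero around every cycle; this gives necessity. Conversely, if φ and ψ
-- agree on all cycles, the dart function ψ − φ sums to zero around every cycle, hence, by loop
-- erasure (back-and-forth walks being excluded by simplicity), around every closed walk; on the
-- connected graph G it is therefore the coboundary δH of an integer potential H. The labellings
-- φ + δ(H ⊓ k) run from φ (k ≤ min H) to ψ (k ≥ max H); each lies edgewise between φ and ψ, so is a
-- (p,q)-labelling, and passing from k to k + 1 is the edge cut relabelling by 1 on ∂{v : k < H v}.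

module Submission where

open import Defs

open import Algebra.Bundles using (CommutativeMonoid)
import Algebra.Properties.CommutativeMonoid.Sum as Sum
open import Data.Bool using (Bool; true; false; if_then_else_; _≟_)
open import Data.Bool.Properties using (¬-not)
open import Data.Fin using (Fin; zero; suc; toℕ; fromℕ; inject₁)
open import Data.Fin.Properties using (any?; toℕ-injective; toℕ-fromℕ<; toℕ-inject₁; toℕ<n; toℕ-fromℕ)
open import Data.Integer as ℤ using (ℤ; +_; _+_; _-_; -_; ∣_∣; _⊓_; +≤+)
import Data.Integer.Properties as ℤ
open import Data.Integer.Tactic.RingSolver using (solve-∀)
open import Data.List as List using (List; []; _∷_; tabulate; allFin)
import Data.List.Membership.DecPropositional as DecMembership
open import Data.List.Membership.Propositional using (_∈_)
open import Data.List.Membership.Propositional.Properties using (∈-lookup)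
open import Data.List.Properties using (map-tabulate; map-cong)
open import Data.List.Relation.Binary.Subset.Propositional using (_⊆_)
open import Data.List.Relation.Unary.All as All using (All; []; _∷_)
import Data.List.Relation.Unary.All.Properties as All
open import Data.List.Relation.Unary.AllPairs using (AllPairs; []; _∷_)
open import Data.List.Relation.Unary.Any using (here; there)
open import Data.List.Relation.Unary.Unique.Propositional using (Unique)
open import Data.Nat as ℕ using (ℕ; zero; suc; z≤n; s≤s; _<?_; _≤_; _*_; _∸_)
import Data.Nat.Properties as ℕ
open import Data.Nat.Divisibility using (_∣_)
import Data.Nat.ListAction as ℕ
open import Data.Product using (Σ; _×_; _,_; proj₁; proj₂; ∃; uncurry)
open import Data.Sum using (_⊎_; inj₁; inj₂)
open import Data.Vec.Functional using (Vector; init)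
open import Function using (_∘_)
open import Relation.Nullary using (¬_; yes; no; does; contradiction)
open import Relation.Binary.PropositionalEquality using (_≡_; _≢_; _≗_; refl; sym; trans; cong; cong₂; subst; module ≡-Reasoning)
open import Relation.Binary.Construct.Closure.ReflexiveTransitive using (Star; ε; _◅_; _◅◅_)

next-inject₁ : ∀ {k} (j : Fin k) → next (inject₁ j) ≡ suc j
next-inject₁ {k} j with suc (toℕ (inject₁ j)) <? suc k
... | yes lt = toℕ-injective (trans (toℕ-fromℕ< lt) (cong suc (toℕ-inject₁ j)))
... | no ≮ = contradiction (s≤s (subst (ℕ._< k) (sym (toℕ-inject₁ j)) (toℕ<n j))) ≮

next-fromℕ : ∀ k → next (fromℕ k) ≡ zero
next-fromℕ k with suc (toℕ (fromℕ k)) <? suc k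
... | yes lt = contradiction (subst (ℕ._< k) (toℕ-fromℕ k) (ℕ.≤-pred lt)) (ℕ.<-irrefl refl)
... | no _ = refl

inject₁-or-fromℕ : ∀ {k} (i : Fin (suc k)) → (∃ λ j → i ≡ inject₁ j) ⊎ i ≡ fromℕ k
inject₁-or-fromℕ {zero} zero = inj₂ refl
inject₁-or-fromℕ {suc k} zero = inj₁ (zero , refl)
inject₁-or-fromℕ {suc k} (suc i) with inject₁-or-fromℕ i
... | inj₁ (j , refl) = inj₁ (suc j , refl)
... | inj₂ refl = inj₂ refl

module _ {c ℓ} (M : CommutativeMonoid c ℓ) where
  open CommutativeMonoid M using (Carrier; _≈_; _∙_; comm; setoid)
  open Sum M
  open import Relation.Binary.Reasoning.Setoid setoid

  sum-rotate : ∀ {k} (f : Vector Carrier k) → sum (f ∘ next) ≈ sum f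
  sum-rotate {zero} f = CommutativeMonoid.refl M
  sum-rotate {suc k} f = begin
    sum (f ∘ next)                             ≈⟨ sum-init-last (f ∘ next) ⟩
    sum (init (f ∘ next)) ∙ f (next (fromℕ k)) ≡⟨ cong₂ _∙_ (sum-cong-≗ (cong f ∘ next-inject₁)) (cong f (next-fromℕ k)) ⟩
    sum (f ∘ suc) ∙ f zero                     ≈⟨ comm _ _ ⟩
    sum f                                      ∎

module ℤ-Sum = Sum ℤ.+-0-commutativeMonoid
open ℤ-Sum using (∑-distrib-+) renaming (sum to ∑)

∑-distrib-- : ∀ {k} (f g : Vector ℤ k) → ∑ (λ i → f i - g i) ≡ ∑ f - ∑ g
∑-distrib-- {zero} f g = refl
∑-distrib-- {suc k} f g =
  trans (cong (_+_ (f zero - g zero)) (∑-distrib-- (f ∘ suc) (g ∘ suc)))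
        (interchange (f zero) (g zero) (∑ (f ∘ suc)) (∑ (g ∘ suc)))
  where
  interchange : ∀ a b c d → (a - b) + (c - d) ≡ (a + c) - (b + d)
  interchange = solve-∀

∑-telescope : ∀ {k} (f g : Vector ℤ k) → ∑ (λ i → f i + (g (next i) - g i)) ≡ ∑ f
∑-telescope f g = begin
  ∑ (λ i → f i + (g (next i) - g i)) ≡⟨ ∑-distrib-+ f _ ⟩
  ∑ f + ∑ (λ i → g (next i) - g i)   ≡⟨ cong (_+_ (∑ f)) (∑-distrib-- (g ∘ next) g) ⟩
  ∑ f + (∑ (g ∘ next) - ∑ g)         ≡⟨ cong (λ s → ∑ f + (s - ∑ g)) (sum-rotate ℤ.+-0-commutativeMonoid g) ⟩
  ∑ f + (∑ g - ∑ g)                  ≡⟨ cong (_+_ (∑ f)) (ℤ.+-inverseʳ (∑ g)) ⟩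
  ∑ f + + 0                          ≡⟨ ℤ.+-identityʳ (∑ f) ⟩
  ∑ f                                ∎
  where open ≡-Reasoning

+-sum-tabulate : ∀ {k} (f : Fin k → ℕ) → + ℕ.sum (tabulate f) ≡ ∑ (+_ ∘ f)
+-sum-tabulate {zero} f = refl
+-sum-tabulate {suc k} f = trans (ℤ.pos-+ (f zero) _) (cong (_+_ (+ f zero)) (+-sum-tabulate (f ∘ suc)))

i+[j-j]≡i : ∀ i j → i + (j - j) ≡ i
i+[j-j]≡i = solve-∀

pos-∸ : ∀ {m n} → n ≤ m → + (m ∸ n) ≡ + m - + n
pos-∸ {m} {n} n≤m = trans (sym (ℤ.⊖-≥ n≤m)) (sym (ℤ.m-n≡m⊖n m n))

⊓-difference-within : ∀ {lo hi} x a b k → lo ℤ.≤ x → x ℤ.≤ hi →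
  lo ℤ.≤ x + (a - b) → x + (a - b) ℤ.≤ hi →
  lo ℤ.≤ x + (a ⊓ k - b ⊓ k) × x + (a ⊓ k - b ⊓ k) ℤ.≤ hi
⊓-difference-within x a b k lo≤x x≤hi lo≤y y≤hi with a ℤ.≤? k | b ℤ.≤? k
... | yes a≤k | yes b≤k rewrite ℤ.i≤j⇒i⊓j≡i a≤k | ℤ.i≤j⇒i⊓j≡i b≤k = lo≤y , y≤hi
... | no a≰k | no b≰k
  rewrite ℤ.i≥j⇒i⊓j≡j (ℤ.<⇒≤ (ℤ.≰⇒> a≰k)) | ℤ.i≥j⇒i⊓j≡j (ℤ.<⇒≤ (ℤ.≰⇒> b≰k)) | i+[j-j]≡i x k =
  lo≤x , x≤hi
... | yes a≤k | no b≰k rewrite ℤ.i≤j⇒i⊓j≡i a≤k | ℤ.i≥j⇒i⊓j≡j (ℤ.<⇒≤ (ℤ.≰⇒> b≰k)) =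
  ℤ.≤-trans lo≤y (ℤ.+-monoʳ-≤ x (ℤ.+-monoʳ-≤ a (ℤ.neg-mono-≤ (ℤ.<⇒≤ (ℤ.≰⇒> b≰k))))) ,
  ℤ.≤-trans (subst (x + (a - k) ℤ.≤_) (ℤ.+-identityʳ x) (ℤ.+-monoʳ-≤ x (ℤ.i≤j⇒i-j≤0 a≤k))) x≤hi
... | no a≰k | yes b≤k rewrite ℤ.i≥j⇒i⊓j≡j (ℤ.<⇒≤ (ℤ.≰⇒> a≰k)) | ℤ.i≤j⇒i⊓j≡i b≤k =
  ℤ.≤-trans lo≤x (subst (ℤ._≤ x + (k - b)) (ℤ.+-identityʳ x) (ℤ.+-monoʳ-≤ x (ℤ.i≤j⇒0≤j-i b≤k))) ,
  ℤ.≤-trans (ℤ.+-monoʳ-≤ x (ℤ.+-monoˡ-≤ (- b) (ℤ.<⇒≤ (ℤ.≰⇒> a≰k)))) y≤hi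

⊓-suc : ∀ i k → i ⊓ ℤ.suc k ≡ i ⊓ k + (if does (k ℤ.<? i) then + 1 else + 0)
⊓-suc i k with k ℤ.<? i
... | yes k<i rewrite ℤ.i≥j⇒i⊓j≡j (ℤ.i<j⇒suc[i]≤j k<i) | ℤ.i≥j⇒i⊓j≡j (ℤ.<⇒≤ k<i) = ℤ.+-comm (+ 1) k
... | no k≮i rewrite ℤ.i≤j⇒i⊓j≡i (ℤ.≤-trans (ℤ.≮⇒≥ k≮i) (ℤ.i≤suc[i] k)) | ℤ.i≤j⇒i⊓j≡i (ℤ.≮⇒≥ k≮i) =
  sym (ℤ.+-identityʳ i)

∣i∣≤n⇒-n≤i≤n : ∀ i n → ∣ i ∣ ≤ n → - + n ℤ.≤ i × i ℤ.≤ + n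
∣i∣≤n⇒-n≤i≤n (+ m) n m≤n = ℤ.neg-≤-pos , +≤+ m≤n
∣i∣≤n⇒-n≤i≤n ℤ.-[1+ m ] (suc n) (s≤s m≤n) = ℤ.-≤- m≤n , ℤ.-≤+

≤-sum-tabulate : ∀ {k} (f : Fin k → ℕ) i → f i ≤ ℕ.sum (tabulate f)
≤-sum-tabulate f zero = ℕ.m≤m+n (f zero) _
≤-sum-tabulate f (suc i) = ℕ.≤-trans (≤-sum-tabulate (f ∘ suc) i) (ℕ.m≤n+m _ (f zero))

AllPairs-lookup-injective : ∀ {A B : Set} (g : A → B) {xs : List A} →
  AllPairs (λ x y → g x ≢ g y) xs → ∀ i j → g (List.lookup xs i) ≡ g (List.lookup xs j) → i ≡ j
AllPairs-lookup-injective g (_ ∷ _) zero zero _ = refl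
AllPairs-lookup-injective g (x≢ ∷ _) zero (suc j) eq = contradiction eq (All.lookup x≢ (∈-lookup j))
AllPairs-lookup-injective g (x≢ ∷ _) (suc i) zero eq = contradiction (sym eq) (All.lookup x≢ (∈-lookup i))
AllPairs-lookup-injective g (_ ∷ ≢s) (suc i) (suc j) eq = cong suc (AllPairs-lookup-injective g ≢s i j eq)

inhabited-or-empty : ∀ k → Fin k ⊎ ¬ Fin k
inhabited-or-empty zero = inj₂ λ ()
inhabited-or-empty (suc k) = inj₁ zero

module CycleValues (G : OrientedGraph) (p : ℕ) where
  open OrientedGraph G

  AtMost : Labelling G → Set
  AtMost φ = ∀ e → φ e ≤ p

  DiffersByCoboundary : Labelling G → Labelling G → (Fin n → ℤ) → Set
  DiffersByCoboundary φ χ H = ∀ e → + χ e ≡ + φ e + (H (head e) - H (tail e))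

  +cycleValue : ∀ φ (C : Cycle G) →
    + cycleValue G p φ C ≡ ∑ (λ i → + dartValue G p φ (Cycle.dart C i))
  +cycleValue φ C =
    trans (cong (+_ ∘ ℕ.sum) (map-tabulate (λ i → i) value)) (+-sum-tabulate value)
    where
    value : Fin (Cycle.len C) → ℕ
    value i = dartValue G p φ (Cycle.dart C i)

  dartValue-coboundary : ∀ {φ χ H} → AtMost φ → AtMost χ → DiffersByCoboundary φ χ H →
    ∀ d → + dartValue G p χ d ≡ + dartValue G p φ d + (H (tgt G d) - H (src G d))
  dartValue-coboundary φ≤p χ≤p χ≡φ+δH (e , true) = χ≡φ+δH e
  dartValue-coboundary {φ} {χ} {H} φ≤p χ≤p χ≡φ+δH (e , false) = begin
    + (p ∸ χ e)                               ≡⟨ pos-∸ (χ≤p e) ⟩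
    + p - + χ e                               ≡⟨ cong (λ x → + p - x) (χ≡φ+δH e) ⟩
    + p - (+ φ e + (H (head e) - H (tail e))) ≡⟨ rearrange (+ p) (+ φ e) (H (head e)) (H (tail e)) ⟩
    + p - + φ e + (H (tail e) - H (head e))   ≡⟨ cong (λ x → x + _) (sym (pos-∸ (φ≤p e))) ⟩
    + (p ∸ φ e) + (H (tail e) - H (head e))   ∎
    where
    open ≡-Reasoning
    rearrange : ∀ P x a b → P - (x + (a - b)) ≡ P - x + (b - a)
    rearrange = solve-∀

  cycleValue-coboundary : ∀ {φ χ H} → AtMost φ → AtMost χ → DiffersByCoboundary φ χ H →
    ∀ C → cycleValue G p χ C ≡ cycleValue G p φ C
  cycleValue-coboundary {φ} {χ} {H} φ≤p χ≤p χ≡φ+δH C = ℤ.+-injective (begin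
    + cycleValue G p χ C                                      ≡⟨ +cycleValue χ C ⟩
    ∑ (λ i → + dartValue G p χ (dart i))                      ≡⟨ ℤ-Sum.sum-cong-≗ dart-step ⟩
    ∑ (λ i → + dartValue G p φ (dart i) + (B (next i) - B i)) ≡⟨ ∑-telescope _ B ⟩
    ∑ (λ i → + dartValue G p φ (dart i))                      ≡⟨ sym (+cycleValue φ C) ⟩
    + cycleValue G p φ C                                      ∎)
    where
    open ≡-Reasoning
    open Cycle C
    B : Fin len → ℤ
    B i = H (src G (dart i))
    dart-step : ∀ i → + dartValue G p χ (dart i) ≡ + dartValue G p φ (dart i) + (B (next i) - B i)
    dart-step i = trans (dartValue-coboundary {H = H} φ≤p χ≤p χ≡φ+δH (dart i))
                        (cong (λ v → + dartValue G p φ (dart i) + (H v - B i)) (closed i))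

  cycleValue-cong : ∀ {φ χ} → φ ≗ χ → ∀ C → cycleValue G p φ C ≡ cycleValue G p χ C
  cycleValue-cong {φ} {χ} φ≗χ C = cong ℕ.sum (map-cong (dartValue-cong ∘ Cycle.dart C) (allFin _))
    where
    dartValue-cong : ∀ d → dartValue G p φ d ≡ dartValue G p χ d
    dartValue-cong (e , true) = φ≗χ e
    dartValue-cong (e , false) = cong (p ∸_) (φ≗χ e)

module EdgeCuts (G : OrientedGraph) (p q : ℕ) where
  open OrientedGraph G
  open CycleValues G p

  cutPotential : (Fin n → Bool) → ℕ → Fin n → ℤ
  cutPotential X α v = if X v then + α else + 0

  relabel-coboundary : ∀ X α φ → (∀ e → Out G X e → α ≤ φ e) →
    DiffersByCoboundary φ (relabel G X α φ) (cutPotential X α)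
  relabel-coboundary X α φ α≤out e with X (tail e) in t | X (head e) in h
  ... | true  | false = trans (pos-∸ (α≤out e (t , h))) (cong (_+_ (+ φ e)) (sym (ℤ.+-identityˡ (- + α))))
  ... | false | true  = trans (ℤ.pos-+ (φ e) α) (cong (_+_ (+ φ e)) (sym (ℤ.+-identityʳ (+ α))))
  ... | true  | true  = sym (i+[j-j]≡i (+ φ e) (+ α))
  ... | false | false = sym (i+[j-j]≡i (+ φ e) (+ 0))

  relabel-out : ∀ X α φ e → Out G X e → relabel G X α φ e ≡ φ e ∸ α
  relabel-out X α φ e (t , h) rewrite t | h = refl

  relabel-in : ∀ X α φ e → In G X e → relabel G X α φ e ≡ φ e ℕ.+ α
  relabel-in X α φ e (t , h) rewrite t | h = refl

  relabel-uncut : ∀ X α φ e → X (tail e) ≡ X (head e) → relabel G X α φ e ≡ φ e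
  relabel-uncut X α φ e same with X (tail e) | X (head e)
  ... | true  | true  = refl
  ... | false | false = refl
  ... | true  | false = contradiction same λ ()
  ... | false | true  = contradiction same λ ()

  relabel-≤ : ∀ X α φ e → φ e ≤ p → (In G X e → φ e ℕ.+ α ≤ p) → relabel G X α φ e ≤ p
  relabel-≤ X α φ e φ≤p in≤p with X (tail e) | X (head e)
  ... | true  | false = ℕ.≤-trans (ℕ.m∸n≤m (φ e) α) φ≤p
  ... | false | true  = in≤p (refl , refl)
  ... | true  | true  = φ≤p
  ... | false | false = φ≤p

  IsPQLabelling⇒AtMost : ∀ {φ} → IsPQLabelling G p q φ → AtMost φ
  IsPQLabelling⇒AtMost pq e = ℕ.≤-trans (proj₂ (proj₁ pq e)) (ℕ.m∸n≤m p q)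

  cycleValue-edgeCutRelabelling : ∀ {φ φ'} → EdgeCutRelabelling G p q φ φ' →
    ∀ C → cycleValue G p φ' C ≡ cycleValue G p φ C
  cycleValue-edgeCutRelabelling {φ} {φ'} (pq , X , _ , _ , α , _ , _ , out≥ , in≤ , φ'≗) =
    cycleValue-coboundary {H = cutPotential X α} φ≤p φ'≤p φ'≡φ+δH
    where
    φ≤p : AtMost φ
    φ≤p = IsPQLabelling⇒AtMost pq
    φ'≤p : AtMost φ'
    φ'≤p e = subst (_≤ p) (sym (φ'≗ e))
      (relabel-≤ X α φ e (φ≤p e) (λ i → ℕ.≤-trans (in≤ e i) (ℕ.m∸n≤m p q)))
    φ'≡φ+δH : DiffersByCoboundary φ φ' (cutPotential X α)
    φ'≡φ+δH e = trans (cong +_ (φ'≗ e))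
      (relabel-coboundary X α φ (λ e o → ℕ.m+n≤o⇒n≤o q (out≥ e o)) e)

  cycleValue-reconfiguration : ∀ {φ χ} → Star (EdgeCutRelabelling G p q) φ χ →
    ∀ C → cycleValue G p χ C ≡ cycleValue G p φ C
  cycleValue-reconfiguration ε C = refl
  cycleValue-reconfiguration (step ◅ steps) C =
    trans (cycleValue-reconfiguration steps C) (cycleValue-edgeCutRelabelling step C)

module Potentials (G : OrientedGraph) (f : Dart G → ℤ)
  (f-reverse : ∀ e → f (e , false) ≡ - f (e , true))
  (f-cycle : ∀ (C : Cycle G) → ∑ (f ∘ Cycle.dart C) ≡ + 0) where
  open OrientedGraph G
  open DecMembership (Data.Fin._≟_ {n}) using (_∈?_)

  Walk : Fin n → Fin n → Set
  Walk = Star (Adj G)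

  dartOf : ∀ {u v} → Adj G u v → Dart G
  dartOf (e , inj₁ _) = e , true
  dartOf (e , inj₂ _) = e , false

  src-dartOf : ∀ {u v} (a : Adj G u v) → src G (dartOf a) ≡ u
  src-dartOf (e , inj₁ (t , _)) = t
  src-dartOf (e , inj₂ (_ , h)) = h

  tgt-dartOf : ∀ {u v} (a : Adj G u v) → tgt G (dartOf a) ≡ v
  tgt-dartOf (e , inj₁ (_ , h)) = h
  tgt-dartOf (e , inj₂ (t , _)) = t

  darts : ∀ {u v} → Walk u v → List (Dart G)
  darts ε = []
  darts (a ◅ W) = dartOf a ∷ darts W

  vertices : ∀ {u v} → Walk u v → List (Fin n)
  vertices {u} ε = u ∷ []
  vertices {u} (a ◅ W) = u ∷ vertices W

  IsPath : ∀ {u v} → Walk u v → Set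
  IsPath W = Unique (vertices W)

  walkSum : ∀ {u v} → Walk u v → ℤ
  walkSum ε = + 0
  walkSum (a ◅ W) = f (dartOf a) + walkSum W

  walkSum-◅◅ : ∀ {u v w} (W₁ : Walk u v) (W₂ : Walk v w) → walkSum (W₁ ◅◅ W₂) ≡ walkSum W₁ + walkSum W₂
  walkSum-◅◅ ε W₂ = sym (ℤ.+-identityˡ _)
  walkSum-◅◅ (a ◅ W₁) W₂ =
    trans (cong (_+_ (f (dartOf a))) (walkSum-◅◅ W₁ W₂)) (sym (ℤ.+-assoc (f (dartOf a)) _ _))

  SourcesDiffer : Dart G → Dart G → Set
  SourcesDiffer d d' = src G d ≢ src G d'

  ∑-lookup-darts : ∀ {u v} (W : Walk u v) → ∑ (f ∘ List.lookup (darts W)) ≡ walkSum W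
  ∑-lookup-darts ε = refl
  ∑-lookup-darts (a ◅ W) = cong (_+_ (f (dartOf a))) (∑-lookup-darts W)

  tgt-lookup-inject₁ : ∀ {u w v} (a : Adj G u w) (W : Walk w v) (j : Fin (List.length (darts W))) →
    tgt G (List.lookup (darts (a ◅ W)) (inject₁ j)) ≡ src G (List.lookup (darts W) j)
  tgt-lookup-inject₁ a (b ◅ W) zero = trans (tgt-dartOf a) (sym (src-dartOf b))
  tgt-lookup-inject₁ a (b ◅ W) (suc j) = tgt-lookup-inject₁ b W j

  tgt-lookup-last : ∀ {u w v} (a : Adj G u w) (W : Walk w v) →
    tgt G (List.lookup (darts (a ◅ W)) (fromℕ (List.length (darts W)))) ≡ v
  tgt-lookup-last a ε = tgt-dartOf a
  tgt-lookup-last a (b ◅ W) = tgt-lookup-last b W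

  walkSum-cycle : ∀ {u w} (a : Adj G u w) (W : Walk w u) → 2 ≤ List.length (darts W) →
    AllPairs SourcesDiffer (darts (a ◅ W)) → walkSum (a ◅ W) ≡ + 0
  walkSum-cycle a W 2≤len distinct = trans (sym (∑-lookup-darts (a ◅ W))) (f-cycle C)
    where
    ds = darts (a ◅ W)
    closed : ∀ i → tgt G (List.lookup ds i) ≡ src G (List.lookup ds (next i))
    closed i with inject₁-or-fromℕ i
    ... | inj₁ (j , refl) =
      trans (tgt-lookup-inject₁ a W j) (cong (src G ∘ List.lookup ds) (sym (next-inject₁ j)))
    ... | inj₂ refl = trans (tgt-lookup-last a W) (trans (sym (src-dartOf a))
      (cong (src G ∘ List.lookup ds) (sym (next-fromℕ _))))
    C : Cycle G
    C = record
      { len = List.length ds ; len≥3 = s≤s 2≤len ; dart = List.lookup ds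
      ; closed = closed ; distinct = AllPairs-lookup-injective (src G) distinct }

  f-backAndForth : ∀ {u w} (a : Adj G u w) (b : Adj G w u) → f (dartOf a) + f (dartOf b) ≡ + 0
  f-backAndForth (e , inj₁ (te , he)) (e' , inj₁ (te' , he'))
    with refl ← simple e e' (inj₂ (trans te (sym he') , trans he (sym te'))) =
    contradiction (trans te (sym he')) (loopless e)
  f-backAndForth (e , inj₁ (te , he)) (e' , inj₂ (te' , he'))
    with refl ← simple e e' (inj₁ (trans te (sym te') , trans he (sym he'))) =
    trans (cong (_+_ (f (e , true))) (f-reverse e)) (ℤ.+-inverseʳ (f (e , true)))
  f-backAndForth (e , inj₂ (te , he)) (e' , inj₁ (te' , he'))
    with refl ← simple e e' (inj₁ (trans te (sym te') , trans he (sym he'))) =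
    trans (cong (λ x → x + f (e , true)) (f-reverse e)) (ℤ.+-inverseˡ (f (e , true)))
  f-backAndForth (e , inj₂ (te , he)) (e' , inj₂ (te' , he'))
    with refl ← simple e e' (inj₂ (trans te (sym he') , trans he (sym te'))) =
    contradiction (trans te (sym he')) (loopless e)

  end∈vertices : ∀ {u v} (W : Walk u v) → v ∈ vertices W
  end∈vertices ε = here refl
  end∈vertices (a ◅ W) = there (end∈vertices W)

  All-sources : ∀ {P : Fin n → Set} {u v} (W : Walk u v) → All P (vertices W) → All (P ∘ src G) (darts W)
  All-sources ε _ = []
  All-sources {P} (a ◅ W) (pu ∷ ps) = subst P (sym (src-dartOf a)) pu ∷ All-sources W ps

  path-sources-distinct : ∀ {u v} (P : Walk u v) → IsPath P → AllPairs SourcesDiffer (darts P)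
  path-sources-distinct ε _ = []
  path-sources-distinct (a ◅ P) (u∉ ∷ path) =
    All.map (λ u≢ eq → u≢ (trans (sym (src-dartOf a)) eq)) (All-sources P u∉)
    ∷ path-sources-distinct P path

  path-sources-≢-end : ∀ {u v} (P : Walk u v) → IsPath P → All (λ d → src G d ≢ v) (darts P)
  path-sources-≢-end ε _ = []
  path-sources-≢-end (a ◅ P) (u∉ ∷ path) =
    (λ eq → All.lookup u∉ (end∈vertices P) (trans (sym (src-dartOf a)) eq))
    ∷ path-sources-≢-end P path

  walkSum-closingPath : ∀ {u w} (a : Adj G u w) (P : Walk w u) → IsPath P → walkSum (a ◅ P) ≡ + 0
  walkSum-closingPath a ε _ =
    contradiction (trans (src-dartOf a) (sym (tgt-dartOf a))) (loopless-dart (dartOf a))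
    where
    loopless-dart : ∀ d → src G d ≢ tgt G d
    loopless-dart (e , true) = loopless e
    loopless-dart (e , false) = loopless e ∘ sym
  -- A closed walk of length two is not a Cycle; by simplicity it runs along one edge and back.
  walkSum-closingPath a (b ◅ ε) _ =
    trans (cong (_+_ (f (dartOf a))) (ℤ.+-identityʳ (f (dartOf b)))) (f-backAndForth a b)
  walkSum-closingPath a P@(_ ◅ _ ◅ _) path = walkSum-cycle a P (s≤s (s≤s z≤n))
    (All.map (λ ≢u eq → ≢u (trans (sym eq) (src-dartOf a))) (path-sources-≢-end P path)
     ∷ path-sources-distinct P path)

  record PathSplit {u v} (P : Walk u v) (x : Fin n) : Set where
    field
      prefix        : Walk u x
      suffix        : Walk x v
      prefix-path   : IsPath prefix
      suffix-path   : IsPath suffix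
      prefix-⊆      : vertices prefix ⊆ vertices P
      walkSum-split : walkSum P ≡ walkSum prefix + walkSum suffix

  splitPath : ∀ {u v x} (P : Walk u v) → IsPath P → x ∈ vertices P → PathSplit P x
  splitPath ε path (here refl) = record
    { prefix = ε ; suffix = ε ; prefix-path = path ; suffix-path = path
    ; prefix-⊆ = λ x∈ → x∈ ; walkSum-split = refl }
  splitPath P@(_ ◅ _) path (here refl) = record
    { prefix = ε ; suffix = P ; prefix-path = [] ∷ [] ; suffix-path = path
    ; prefix-⊆ = λ { (here refl) → here refl } ; walkSum-split = sym (ℤ.+-identityˡ _) }
  splitPath (a ◅ P) (u∉ ∷ path) (there x∈) = record
    { prefix = a ◅ prefix ; suffix = suffix
    ; prefix-path = All.anti-mono prefix-⊆ u∉ ∷ prefix-path ; suffix-path = suffix-path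
    ; prefix-⊆ = λ { (here eq) → here eq ; (there y∈) → there (prefix-⊆ y∈) }
    ; walkSum-split = trans (cong (_+_ (f (dartOf a))) walkSum-split)
                            (sym (ℤ.+-assoc (f (dartOf a)) (walkSum prefix) (walkSum suffix))) }
    where open PathSplit (splitPath P path x∈)

  loopErasure : ∀ {u v} (W : Walk u v) → Σ (Walk u v) λ P → IsPath P × walkSum P ≡ walkSum W
  loopErasure ε = ε , [] ∷ [] , refl
  loopErasure {u} (a ◅ W) with loopErasure W
  ... | P , path , P≡W with u ∈? vertices P
  ...   | no u∉ = a ◅ P , All.¬Any⇒All¬ (vertices P) u∉ ∷ path , cong (_+_ (f (dartOf a))) P≡W
  ...   | yes u∈ = suffix , suffix-path , sym (begin
    f (dartOf a) + walkSum W
      ≡⟨ cong (_+_ (f (dartOf a))) (trans (sym P≡W) walkSum-split) ⟩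
    f (dartOf a) + (walkSum prefix + walkSum suffix)
      ≡⟨ sym (ℤ.+-assoc (f (dartOf a)) _ _) ⟩
    walkSum (a ◅ prefix) + walkSum suffix
      ≡⟨ cong (_+ walkSum suffix) (walkSum-closingPath a prefix prefix-path) ⟩
    + 0 + walkSum suffix                             ≡⟨ ℤ.+-identityˡ _ ⟩
    walkSum suffix                                   ∎)
    where
    open ≡-Reasoning
    open PathSplit (splitPath P path u∈)

  walkSum-closed : ∀ {u} (W : Walk u u) → walkSum W ≡ + 0
  walkSum-closed W with loopErasure W
  ... | ε , _ , ε≡W = sym ε≡W
  ... | a ◅ P , u∉ ∷ _ , _ = contradiction refl (All.lookup u∉ (end∈vertices P))

  potential : Connected G → Fin n → Σ (Fin n → ℤ) λ g → ∀ e → f (e , true) ≡ g (head e) - g (tail e)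
  potential connected root = g , f≡δg
    where
    g : Fin n → ℤ
    g v = walkSum (connected root v)
    f≡δg : ∀ e → f (e , true) ≡ g (head e) - g (tail e)
    f≡δg e = begin
      f⁺                                    ≡⟨ rearrange f⁺ (g (head e)) (g (tail e)) back ⟩
      (g (tail e) + f⁺ + back) - (g (head e) + back) + (g (head e) - g (tail e))
        ≡⟨ cong₂ (λ x y → x - y + (g (head e) - g (tail e))) around-edge around-head ⟩
      + 0 - + 0 + (g (head e) - g (tail e)) ≡⟨ ℤ.+-identityˡ _ ⟩
      g (head e) - g (tail e)               ∎
      where
      open ≡-Reasoning
      f⁺ = f (e , true)
      back = walkSum (connected (head e) root)
      rearrange : ∀ x a b r → x ≡ (b + x + r) - (a + r) + (a - b)
      rearrange = solve-∀
      around-edge : g (tail e) + f⁺ + back ≡ + 0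
      around-edge = trans (ℤ.+-assoc (g (tail e)) f⁺ back)
        (trans (sym (walkSum-◅◅ (connected root (tail e)) edgeAndBack))
               (walkSum-closed (connected root (tail e) ◅◅ edgeAndBack)))
        where
        edgeAndBack : Walk (tail e) root
        edgeAndBack = (e , inj₁ (refl , refl)) ◅ connected (head e) root
      around-head : g (head e) + back ≡ + 0
      around-head = trans (sym (walkSum-◅◅ (connected root (head e)) (connected (head e) root)))
        (walkSum-closed (connected root (head e) ◅◅ connected (head e) root))

sameCycleValues⇒coboundary : (G : OrientedGraph) (p : ℕ) → Connected G → Fin (OrientedGraph.n G) →
  ∀ {φ ψ} → CycleValues.AtMost G p φ → CycleValues.AtMost G p ψ →
  (∀ C → cycleValue G p φ C ≡ cycleValue G p ψ C) →
  Σ (Fin (OrientedGraph.n G) → ℤ) (CycleValues.DiffersByCoboundary G p φ ψ)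
sameCycleValues⇒coboundary G p connected root {φ} {ψ} φ≤p ψ≤p same = H , ψ≡φ+δH
  where
  open OrientedGraph G
  open CycleValues G p
  gap : Dart G → ℤ
  gap d = + dartValue G p ψ d - + dartValue G p φ d
  gap-reverse : ∀ e → gap (e , false) ≡ - gap (e , true)
  gap-reverse e = trans (cong₂ _-_ (pos-∸ (ψ≤p e)) (pos-∸ (φ≤p e))) (negate (+ p) (+ ψ e) (+ φ e))
    where
    negate : ∀ P y x → (P - y) - (P - x) ≡ - (y - x)
    negate = solve-∀
  gap-cycle : ∀ C → ∑ (gap ∘ Cycle.dart C) ≡ + 0
  gap-cycle C = begin
    ∑ (gap ∘ Cycle.dart C)                      ≡⟨ ∑-distrib-- (value ψ) (value φ) ⟩
    ∑ (value ψ) - ∑ (value φ)                   ≡⟨ cong₂ _-_ (sym (+cycleValue ψ C)) (sym (+cycleValue φ C)) ⟩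
    + cycleValue G p ψ C - + cycleValue G p φ C ≡⟨ cong (λ x → + cycleValue G p ψ C - + x) (same C) ⟩
    + cycleValue G p ψ C - + cycleValue G p ψ C ≡⟨ ℤ.+-inverseʳ (+ cycleValue G p ψ C) ⟩
    + 0                                         ∎
    where
    open ≡-Reasoning
    value : Labelling G → Fin (Cycle.len C) → ℤ
    value χ i = + dartValue G p χ (Cycle.dart C i)
  open Potentials G gap gap-reverse gap-cycle using (potential)
  H : Fin n → ℤ
  H = proj₁ (potential connected root)
  ψ≡φ+δH : DiffersByCoboundary φ ψ H
  ψ≡φ+δH e = trans (shift (+ ψ e) (+ φ e)) (cong (_+_ (+ φ e)) (proj₂ (potential connected root) e))
    where
    shift : ∀ y x → y ≡ x + (y - x)
    shift = solve-∀

module Interpolation (G : OrientedGraph) (p q : ℕ) (1≤q : 1 ≤ q) (2q≤p : 2 * q ≤ p)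
  {φ ψ : Labelling G} (φ-pq : IsPQLabelling G p q φ) (ψ-pq : IsPQLabelling G p q ψ)
  (H : Fin (OrientedGraph.n G) → ℤ) (ψ≡φ+δH : CycleValues.DiffersByCoboundary G p φ ψ H) where
  open OrientedGraph G
  open CycleValues G p
  open EdgeCuts G p q

  interpolantℤ : ℤ → Fin m → ℤ
  interpolantℤ k e = + φ e + (H (head e) ⊓ k - H (tail e) ⊓ k)

  interpolantℤ-bounds : ∀ k e → + q ℤ.≤ interpolantℤ k e × interpolantℤ k e ℤ.≤ + (p ∸ q)
  interpolantℤ-bounds k e = ⊓-difference-within (+ φ e) (H (head e)) (H (tail e)) k
    (+≤+ (proj₁ (proj₁ φ-pq e))) (+≤+ (proj₂ (proj₁ φ-pq e)))
    (subst (+ q ℤ.≤_) (ψ≡φ+δH e) (+≤+ (proj₁ (proj₁ ψ-pq e))))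
    (subst (ℤ._≤ + (p ∸ q)) (ψ≡φ+δH e) (+≤+ (proj₂ (proj₁ ψ-pq e))))

  interpolant : ℤ → Labelling G
  interpolant k e = ∣ interpolantℤ k e ∣

  +interpolant : ∀ k e → + interpolant k e ≡ interpolantℤ k e
  +interpolant k e = ℤ.0≤i⇒+∣i∣≡i (ℤ.≤-trans (+≤+ z≤n) (proj₁ (interpolantℤ-bounds k e)))

  q≤interpolant : ∀ k e → q ≤ interpolant k e
  q≤interpolant k e = ℤ.drop‿+≤+ (subst (+ q ℤ.≤_) (sym (+interpolant k e)) (proj₁ (interpolantℤ-bounds k e)))

  interpolant≤p-q : ∀ k e → interpolant k e ≤ p ∸ q
  interpolant≤p-q k e =
    ℤ.drop‿+≤+ (subst (ℤ._≤ + (p ∸ q)) (sym (+interpolant k e)) (proj₂ (interpolantℤ-bounds k e)))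

  interpolant-positive : ∀ k {χ} → χ ≗ interpolant k → ∀ e → 1 ≤ χ e
  interpolant-positive k χ≗ e = subst (1 ≤_) (sym (χ≗ e)) (ℕ.≤-trans 1≤q (q≤interpolant k e))

  interpolant-isPQ : ∀ k {χ} → χ ≗ interpolant k → IsPQLabelling G p q χ
  interpolant-isPQ k {χ} χ≗ = bounds , λ C → subst (p ∣_) (sym (same-cycleValues C)) (proj₂ φ-pq C)
    where
    bounds : ∀ e → q ≤ χ e × χ e ≤ p ∸ q
    bounds e rewrite χ≗ e = q≤interpolant k e , interpolant≤p-q k e
    same-cycleValues : ∀ C → cycleValue G p χ C ≡ cycleValue G p φ C
    same-cycleValues = cycleValue-coboundary {H = λ v → H v ⊓ k}
      (IsPQLabelling⇒AtMost φ-pq) (λ e → ℕ.≤-trans (proj₂ (bounds e)) (ℕ.m∸n≤m p q))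
      (λ e → trans (cong +_ (χ≗ e)) (+interpolant k e))

  cut : ℤ → Fin n → Bool
  cut k v = does (k ℤ.<? H v)

  interpolant-suc : ∀ k {χ} → χ ≗ interpolant k →
    ∀ e → interpolant (ℤ.suc k) e ≡ relabel G (cut k) 1 χ e
  interpolant-suc k {χ} χ≗ e = ℤ.+-injective (begin
    + interpolant (ℤ.suc k) e
      ≡⟨ +interpolant (ℤ.suc k) e ⟩
    + φ e + (H (head e) ⊓ ℤ.suc k - H (tail e) ⊓ ℤ.suc k)
      ≡⟨ cong₂ (λ a b → + φ e + (a - b)) (⊓-suc (H (head e)) k) (⊓-suc (H (tail e)) k) ⟩
    + φ e + ((H (head e) ⊓ k + δ (head e)) - (H (tail e) ⊓ k + δ (tail e)))
      ≡⟨ regroup (+ φ e) (H (head e) ⊓ k) (H (tail e) ⊓ k) (δ (head e)) (δ (tail e)) ⟩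
    interpolantℤ k e + (δ (head e) - δ (tail e))
      ≡⟨ cong (_+ (δ (head e) - δ (tail e))) (sym (trans (cong +_ (χ≗ e)) (+interpolant k e))) ⟩
    + χ e + (δ (head e) - δ (tail e))
      ≡⟨ sym (relabel-coboundary (cut k) 1 χ (λ e _ → interpolant-positive k χ≗ e) e) ⟩
    + relabel G (cut k) 1 χ e ∎)
    where
    open ≡-Reasoning
    δ : Fin n → ℤ
    δ = cutPotential (cut k) 1
    regroup : ∀ x a b i j → x + ((a + i) - (b + j)) ≡ (x + (a - b)) + (i - j)
    regroup = solve-∀

  edgeCutRelabelling-suc : ∀ k {χ} → χ ≗ interpolant k →
    (∃ λ v → cut k v ≡ true) → (∃ λ v → cut k v ≡ false) →
    EdgeCutRelabelling G p q χ (interpolant (ℤ.suc k))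
  edgeCutRelabelling-suc k {χ} χ≗ inside outside =
    interpolant-isPQ k χ≗ , cut k , inside , outside , 1 , ℕ.≤-refl , 1≤p∸1 ,
    out-bound , in-bound , interpolant-suc k χ≗
    where
    1≤p∸1 : 1 ≤ p ∸ 1
    1≤p∸1 = ℕ.m+n≤o⇒m≤o∸n 1 (ℕ.≤-trans (ℕ.*-monoʳ-≤ 2 1≤q) 2q≤p)
    out-bound : ∀ e → Out G (cut k) e → q ℕ.+ 1 ≤ χ e
    out-bound e out = ℕ.m≤o∸n⇒m+n≤o q (interpolant-positive k χ≗ e) (subst (q ≤_)
      (trans (interpolant-suc k χ≗ e) (relabel-out (cut k) 1 χ e out)) (q≤interpolant (ℤ.suc k) e))
    in-bound : ∀ e → In G (cut k) e → χ e ℕ.+ 1 ≤ p ∸ q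
    in-bound e into = subst (_≤ p ∸ q)
      (trans (interpolant-suc k χ≗ e) (relabel-in (cut k) 1 χ e into)) (interpolant≤p-q (ℤ.suc k) e)

  interpolant-suc-uncut : ∀ k {χ} → χ ≗ interpolant k →
    ∀ b → (∀ v → cut k v ≡ b) → ∀ e → χ e ≡ interpolant (ℤ.suc k) e
  interpolant-suc-uncut k {χ} χ≗ b constant e = sym (trans (interpolant-suc k χ≗ e)
    (relabel-uncut (cut k) 1 χ e (trans (constant (tail e)) (sym (constant (head e))))))

  Reachable : ℤ → Set
  Reachable k = Σ (Labelling G) λ χ →
    Star (EdgeCutRelabelling G p q) φ χ × χ ≗ interpolant k

  reachable-suc : ∀ k → Reachable k → Reachable (ℤ.suc k)
  reachable-suc k (χ , steps , χ≗) with any? (λ v → cut k v ≟ true) | any? (λ v → cut k v ≟ false)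
  ... | yes inside | yes outside =
    interpolant (ℤ.suc k) , steps ◅◅ (edgeCutRelabelling-suc k χ≗ inside outside ◅ ε) , λ _ → refl
  ... | no no-inside | _ =
    χ , steps , interpolant-suc-uncut k χ≗ false (λ v → ¬-not (no-inside ∘ (v ,_)))
  ... | yes _ | no no-outside =
    χ , steps , interpolant-suc-uncut k χ≗ true (λ v → ¬-not (no-outside ∘ (v ,_)))

  K : ℕ
  K = ℕ.sum (tabulate (∣_∣ ∘ H))

  H-bounds : ∀ v → - + K ℤ.≤ H v × H v ℤ.≤ + K
  H-bounds v = ∣i∣≤n⇒-n≤i≤n (H v) K (≤-sum-tabulate (∣_∣ ∘ H) v)

  level : ℕ → ℤ
  level t = - + K + + t

  level-suc : ∀ t → ℤ.suc (level t) ≡ level (suc t)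
  level-suc t = shift (- + K) (+ t)
    where
    shift : ∀ a b → + 1 + (a + b) ≡ a + (+ 1 + b)
    shift = solve-∀

  interpolant-start : ∀ e → φ e ≡ interpolant (level 0) e
  interpolant-start e = sym (cong ∣_∣ (trans
    (cong₂ (λ a b → + φ e + (a - b)) (floor (head e)) (floor (tail e))) (i+[j-j]≡i (+ φ e) (level 0))))
    where
    floor : ∀ v → H v ⊓ level 0 ≡ level 0
    floor v = ℤ.i≥j⇒i⊓j≡j (subst (ℤ._≤ H v) (sym (ℤ.+-identityʳ _)) (proj₁ (H-bounds v)))

  interpolant-end : ∀ e → interpolant (level (K ℕ.+ K)) e ≡ ψ e
  interpolant-end e = cong ∣_∣ (trans
    (cong₂ (λ a b → + φ e + (a - b)) (ceiling (head e)) (ceiling (tail e))) (sym (ψ≡φ+δH e)))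
    where
    level-end : level (K ℕ.+ K) ≡ + K
    level-end = trans (cong (_+_ (- + K)) (ℤ.pos-+ K K)) (cancel (+ K))
      where
      cancel : ∀ a → - a + (a + a) ≡ a
      cancel = solve-∀
    ceiling : ∀ v → H v ⊓ level (K ℕ.+ K) ≡ H v
    ceiling v = ℤ.i≤j⇒i⊓j≡i (subst (H v ℤ.≤_) (sym level-end) (proj₂ (H-bounds v)))

  reachable : ∀ t → Reachable (level t)
  reachable zero = φ , ε , interpolant-start
  reachable (suc t) = subst Reachable (level-suc t) (reachable-suc (level t) (reachable t))

  reconfigurable : Reconfigurable G p q φ ψ
  reconfigurable with reachable (K ℕ.+ K)
  ... | χ , steps , χ≗ = χ , steps , λ e → trans (χ≗ e) (interpolant-end e)

theorem2p2 : (p q : ℕ) → 1 ≤ q → 2 * q ≤ p →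
    (G : OrientedGraph) → Connected G →
    (φ ψ : Labelling G) → IsPQLabelling G p q φ → IsPQLabelling G p q ψ →
    (Reconfigurable G p q φ ψ → ∀ (C : Cycle G) → cycleValue G p φ C ≡ cycleValue G p ψ C) ×
    ((∀ (C : Cycle G) → cycleValue G p φ C ≡ cycleValue G p ψ C) → Reconfigurable G p q φ ψ)
theorem2p2 p q 1≤q 2q≤p G connected φ ψ φ-pq ψ-pq = necessity , sufficiency
  where
  open OrientedGraph G
  open CycleValues G p
  open EdgeCuts G p q
  necessity : Reconfigurable G p q φ ψ → ∀ C → cycleValue G p φ C ≡ cycleValue G p ψ C
  necessity (χ , steps , χ≗ψ) C =
    trans (sym (cycleValue-reconfiguration steps C)) (cycleValue-cong χ≗ψ C)
  sufficiency : (∀ C → cycleValue G p φ C ≡ cycleValue G p ψ C) → Reconfigurable G p q φ ψ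
  sufficiency same with inhabited-or-empty n
  ... | inj₂ no-vertex = φ , ε , λ e → contradiction (tail e) no-vertex
  ... | inj₁ root = uncurry (Interpolation.reconfigurable G p q 1≤q 2q≤p φ-pq ψ-pq)
    (sameCycleValues⇒coboundary G p connected root
      (IsPQLabelling⇒AtMost φ-pq) (IsPQLabelling⇒AtMost ψ-pq) same)
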